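{- Let $G$ be a finite, simple, connected graph of order $n$ which has a cycle. If $\beta(G)=n-g(G)+2$, then $G$ is $2$-connected.
   Context: For vertices $x,y$ of a connected graph $G$, $d(x,y)$ denotes the length of a shortest $x$–$y$ path. A set $W\subseteq V(G)$ is a resolving set for $G$ if for every two distinct vertices $u,v\in V(G)$ there exists $w\in W$ with $d(u,w)\neq d(v,w)$. The metric dimension $\beta(G)$ is the minimum cardinality of a resolving set. The girth $g(G)$ is the length of a shortest cycle in $G$. A vertex $v$ is a cut vertex if $G\setminus\{v\}$ has at least two components; $G$ is $2$-connected if it is connected, has at least $3$ vertices, and has no cut vertex. -}

module Defs where

open import Data.Nat using (ℕ; zero; suc; _<_; _≥_)
open import Data.Fin using (Fin; zero; suc; inject₁; fromℕ)
open import Data.Fin.Subset using (Subset; _∈_; ∣_∣)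
open import Data.Product using (Σ; ∃; ∃-syntax; _×_; _,_)
open import Relation.Binary.PropositionalEquality using (_≡_; _≢_)
open import Relation.Nullary using (¬_)
open import Function.Definitions using (Injective)

record Graph (n : ℕ) : Set₁ where
  field
    Adj   : Fin n → Fin n → Set
    sym   : ∀ {x y} → Adj x y → Adj y x
    irrefl : ∀ {x} → ¬ Adj x x
open Graph public

record Walk {n : ℕ} (G : Graph n) (x y : Fin n) (k : ℕ) : Set where
  field
    vtx   : Fin (suc k) → Fin n
    start : vtx zero ≡ x
    end   : vtx (fromℕ k) ≡ y
    step  : ∀ (i : Fin k) → Adj G (vtx (inject₁ i)) (vtx (suc i))
open Walk public

WalkAvoiding : ∀ {n} (G : Graph n) (v x y : Fin n) (k : ℕ) → Set
WalkAvoiding G v x y k = Σ (Walk G x y k) λ w → ∀ i → vtx w i ≢ v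

Connected : ∀ {n} → Graph n → Set
Connected G = ∀ x y → ∃[ k ] Walk G x y k

Dist : ∀ {n} (G : Graph n) → Fin n → Fin n → ℕ → Set
Dist G x y k = Walk G x y k × (∀ j → j < k → ¬ Walk G x y j)

Resolving : ∀ {n} (G : Graph n) → Subset n → Set
Resolving {n} G W = ∀ (u v : Fin n) → u ≢ v →
  ∃[ w ] (w ∈ W × ∃[ a ] ∃[ b ] (Dist G u w a × Dist G v w b × a ≢ b))

MetricDim : ∀ {n} → Graph n → ℕ → Set
MetricDim {n} G b =
  (∃[ W ] (Resolving G W × ∣ W ∣ ≡ b)) ×
  (∀ (W : Subset n) → Resolving G W → ∣ W ∣ ≥ b)

record Cycle {n : ℕ} (G : Graph n) (k : ℕ) : Set where
  field
    m     : ℕ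
    len   : k ≡ suc (suc (suc m))
    cv    : Fin (suc (suc (suc m))) → Fin n
    inj   : Injective _≡_ _≡_ cv
    step  : ∀ (i : Fin (suc (suc m))) → Adj G (cv (inject₁ i)) (cv (suc i))
    close : Adj G (cv (fromℕ (suc (suc m)))) (cv zero)

HasCycle : ∀ {n} → Graph n → Set
HasCycle G = ∃[ k ] Cycle G k

Girth : ∀ {n} → Graph n → ℕ → Set
Girth G g = Cycle G g × (∀ k → k < g → ¬ Cycle G k)

-- v is a cut vertex: G \ {v} has at least two components, i.e. there are
-- two vertices other than v not joined by any walk avoiding v.
CutVertex : ∀ {n} → Graph n → Fin n → Set
CutVertex G v = ∃[ a ] ∃[ b ] (a ≢ v × b ≢ v × (∀ k → ¬ WalkAvoiding G v a b k))

TwoConnected : ∀ {n} → Graph n → Set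
TwoConnected {n} G = Connected G × n ≥ 3 × (∀ v → ¬ CutVertex G v)

module Submission where

-- Let v be a cut vertex and C a shortest cycle, of length g. Since g is the girth, C is
-- isometric: a walk between two vertices of C that is shorter than both arcs can be reduced
-- (splitting it where it meets C, removing backtracks) to one that closes up with an arc into a
-- non-backtracking closed walk of length < g, and such a walk contains a cycle shorter than g.
-- Write C p, C (p + 1), … for the vertices of C, with C p = v if v lies on C, and let x be a
-- neighbour of v in a component of G − v not containing C (p + 1). Then the
-- complement W of O = {v} ∪ {C (p + 2), …, C (p + g − 1)}, a set of g − 1 vertices, resolves G:
-- vertices of C are told apart by their distances to C (p + 1) and to x (when v = C p) or to C p,
-- which by isometry are functions of their positions on C; and v is the only vertex of O
-- adjacent to x. So β(G) ≤ n − g + 1.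

open import Defs renaming (sym to adj-sym)
open import Data.Nat
  using (ℕ; zero; suc; pred; _+_; _∸_; _*_; _⊓_; _≤_; _<_; z≤n; s≤s; s≤s⁻¹; _≤?_; _<?_)
  renaming (_≟_ to _≟ℕ_)
open import Data.Nat.Properties
open import Data.Nat.Induction using (<-rec)
open import Data.Nat.DivMod
  using (_%_; m%n<n; m%n%n≡m%n; [m+n]%n≡m%n; [m+kn]%n≡m%n; %-distribˡ-+; m<n⇒m%n≡m; m≤n⇒[n∸m]%m≡n%m; n%n≡0)
open import Data.Fin using (Fin; zero; suc; toℕ; fromℕ; fromℕ<; inject₁) renaming (_≟_ to _≟ᶠ_)
open import Data.Fin.Properties using (toℕ-fromℕ<; toℕ-fromℕ; toℕ-inject₁; toℕ-injective; toℕ<n; injective⇒≤)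
open import Data.Fin.Subset using (Subset; _∈_; _∉_; ∣_∣; ∁; _-_)
open import Data.Fin.Subset.Properties using (_∈?_; ∣∁p∣≡n∸∣p∣; x∉p⇒x∈∁p; x∉∁p⇒x∈p; x∈p∧x≢y⇒x∈p-y; x∈p⇒∣p-x∣<∣p∣)
open import Data.Vec using (tabulate)
open import Data.Vec.Properties using (lookup∘tabulate; []=⇒lookup; lookup⇒[]=)
open import Data.Product using (Σ; ∃; ∃-syntax; _×_; _,_; proj₁; proj₂)
open import Data.Sum using (_⊎_; inj₁; inj₂)
open import Data.Empty using (⊥; ⊥-elim)
open import Function using (_∘_)
open import Relation.Nullary using (¬_; Dec; yes; no; contradiction)
open import Relation.Nullary.Negation using (¬¬-map)
open import Relation.Nullary.Decidable using (_×-dec_; does; dec-true; ¬?)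
open import Relation.Binary using (tri<; tri≈; tri>)
open import Relation.Binary.PropositionalEquality

¬¬-∀-Fin : ∀ {k} {P : Fin k → Set} → (∀ i → ¬ ¬ P i) → ¬ ¬ (∀ i → P i)
¬¬-∀-Fin {zero}  _     ¬∀ = ¬∀ λ ()
¬¬-∀-Fin {suc k} ¬¬Pᵢ ¬∀ = ¬¬Pᵢ zero λ P₀ → ¬¬-∀-Fin (λ i → ¬¬Pᵢ (suc i)) λ Pₛ → ¬∀ λ
  { zero    → P₀
  ; (suc i) → Pₛ i
  }

¬¬-→ : ∀ {A B : Set} → Dec A → (A → ¬ ¬ B) → ¬ ¬ (A → B)
¬¬-→ (yes a) ¬¬b ¬→ = ¬¬b a λ b → ¬→ λ _ → b
¬¬-→ (no ¬a) _   ¬→ = ¬→ λ a → contradiction a ¬a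

subsetOf : ∀ {n} {P : Fin n → Set} → (∀ u → Dec (P u)) → Subset n
subsetOf P? = tabulate (does ∘ P?)

∈-subsetOf : ∀ {n} {P : Fin n → Set} (P? : ∀ u → Dec (P u)) {u} → P u → u ∈ subsetOf P?
∈-subsetOf P? {u} Pu = lookup⇒[]= u (subsetOf P?) (trans (lookup∘tabulate (does ∘ P?) u) (dec-true (P? u) Pu))

subsetOf-∈ : ∀ {n} {P : Fin n → Set} (P? : ∀ u → Dec (P u)) {u} → u ∈ subsetOf P? → P u
subsetOf-∈ P? {u} u∈ with P? u | trans (sym (lookup∘tabulate (does ∘ P?) u)) ([]=⇒lookup u∈)
... | yes Pu | _ = Pu
... | no _   | ()

injection-into⇒≤∣p∣ : ∀ {n} (p : Subset n) (ε : ℕ → Fin n) {K} →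
  (∀ {i i′} → i < K → i′ < K → ε i ≡ ε i′ → i ≡ i′) → (∀ {i} → i < K → ε i ∈ p) → K ≤ ∣ p ∣
injection-into⇒≤∣p∣ p ε {zero} _ _ = z≤n
injection-into⇒≤∣p∣ p ε {suc K} injective ε∈p =
  <-≤-trans (s≤s (injection-into⇒≤∣p∣ (p - ε K) ε injective′ ε∈p-εK)) (x∈p⇒∣p-x∣<∣p∣ (ε∈p ≤-refl))
  where
  injective′ : ∀ {i i′} → i < K → i′ < K → ε i ≡ ε i′ → i ≡ i′
  injective′ i<K i′<K = injective (m<n⇒m<1+n i<K) (m<n⇒m<1+n i′<K)
  ε∈p-εK : ∀ {i} → i < K → ε i ∈ p - ε K
  ε∈p-εK {i} i<K = x∈p∧x≢y⇒x∈p-y (ε∈p (m<n⇒m<1+n i<K)) λ εi≡εK → <⇒≢ i<K (injective (m<n⇒m<1+n i<K) ≤-refl εi≡εK)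

module _ {n : ℕ} (G : Graph n) where

  record SeqWalk (x y : Fin n) (k : ℕ) : Set where
    constructor seqWalk
    field
      at       : ℕ → Fin n
      at-start : at 0 ≡ x
      at-end   : at k ≡ y
      at-adj   : ∀ i → i < k → Adj G (at i) (at (suc i))

open SeqWalk public

ShortestWalk : ∀ {n} (G : Graph n) → Fin n → Fin n → ℕ → Set
ShortestWalk G x y k = SeqWalk G x y k × (∀ j → j < k → ¬ SeqWalk G x y j)

module _ {n : ℕ} {G : Graph n} where

  Avoids : ∀ {x y k} → Fin n → SeqWalk G x y k → Set
  Avoids {k = k} v w = ∀ i → i ≤ k → at w i ≢ v

  NonBacktracking : ∀ {x y k} → SeqWalk G x y k → Set
  NonBacktracking {k = k} w = ∀ i → suc (suc i) ≤ k → at w i ≢ at w (suc (suc i))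

  cast-start : ∀ {x x′ y k} → x ≡ x′ → SeqWalk G x y k → SeqWalk G x′ y k
  cast-start e w = seqWalk (at w) (trans (at-start w) e) (at-end w) (at-adj w)

  cast-end : ∀ {x y y′ k} → y ≡ y′ → SeqWalk G x y k → SeqWalk G x y′ k
  cast-end e w = seqWalk (at w) (at-start w) (trans (at-end w) e) (at-adj w)

  first-edge : ∀ {x y k} (w : SeqWalk G x y (suc k)) → Adj G x (at w 1)
  first-edge w = subst (λ z → Adj G z (at w 1)) (at-start w) (at-adj w 0 (s≤s z≤n))

  cast-length : ∀ {x y k k′} → k ≡ k′ → SeqWalk G x y k → SeqWalk G x y k′
  cast-length refl w = w

  stay : ∀ x → SeqWalk G x x 0
  stay x = seqWalk (λ _ → x) refl refl (λ _ ())

  edge : ∀ {x y} → Adj G x y → SeqWalk G x y 1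
  edge {x} {y} xy = seqWalk endpoint refl refl adj
    where
    endpoint : ℕ → Fin n
    endpoint zero    = x
    endpoint (suc _) = y
    adj : ∀ i → i < 1 → Adj G (endpoint i) (endpoint (suc i))
    adj zero _ = xy
    adj (suc _) (s≤s ())

  reverse : ∀ {x y k} → SeqWalk G x y k → SeqWalk G y x k
  reverse {k = k} w =
    seqWalk (λ i → at w (k ∸ i)) (at-end w) (trans (cong (at w) (n∸n≡0 k)) (at-start w)) adj
    where
    adj : ∀ i → i < k → Adj G (at w (k ∸ i)) (at w (k ∸ suc i))
    adj i i<k = subst (λ j → Adj G (at w j) (at w (k ∸ suc i))) (sym k∸i≡1+k∸1+i)
                  (adj-sym G (at-adj w (k ∸ suc i) k∸1+i<k))
      where
      k∸i≡1+k∸1+i : k ∸ i ≡ suc (k ∸ suc i)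
      k∸i≡1+k∸1+i = +-∸-assoc 1 i<k
      k∸1+i<k : k ∸ suc i < k
      k∸1+i<k = subst (_≤ k) k∸i≡1+k∸1+i (m∸n≤m k i)

  reverse-avoids : ∀ {x y k v} (w : SeqWalk G x y k) → Avoids v w → Avoids v (reverse w)
  reverse-avoids {k = k} w w-avoids i _ = w-avoids (k ∸ i) (m∸n≤m k i)

  take : ∀ {x y k} (w : SeqWalk G x y k) i → i ≤ k → SeqWalk G x (at w i) i
  take w i i≤k = seqWalk (at w) (at-start w) refl (λ j j<i → at-adj w j (<-≤-trans j<i i≤k))

  drop : ∀ {x y k} (w : SeqWalk G x y k) i l → k ≡ i + l → SeqWalk G (at w i) y l
  drop w i l k≡i+l = seqWalk (λ j → at w (i + j)) (cong (at w) (+-identityʳ i))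
    (trans (cong (at w) (sym k≡i+l)) (at-end w))
    (λ j j<l → subst (λ m → Adj G (at w (i + j)) (at w m)) (sym (+-suc i j))
                 (at-adj w (i + j) (subst (i + j <_) (sym k≡i+l) (+-monoʳ-< i j<l))))

  module Append {x y z k l} (w : SeqWalk G x y k) (u : SeqWalk G y z l) where

    joined : ℕ → Fin n
    joined i with i ≤? k
    ... | yes _ = at w i
    ... | no _  = at u (i ∸ k)

    joined-left : ∀ i → i ≤ k → joined i ≡ at w i
    joined-left i i≤k with i ≤? k
    ... | yes _   = refl
    ... | no  i≰k = contradiction i≤k i≰k

    joined-right : ∀ i → k ≤ i → joined i ≡ at u (i ∸ k)
    joined-right i k≤i with i ≤? k
    ... | no _    = refl
    ... | yes i≤k with ≤-antisym k≤i i≤k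
    ...   | refl  = trans (at-end w) (trans (sym (at-start u)) (cong (at u) (sym (n∸n≡0 k))))

    adj : ∀ i → i < k + l → Adj G (joined i) (joined (suc i))
    adj i i<k+l = by-cases (suc i ≤? k)
      where
      by-cases : Dec (suc i ≤ k) → Adj G (joined i) (joined (suc i))
      by-cases (yes 1+i≤k) =
        subst₂ (Adj G) (sym (joined-left i (<⇒≤ 1+i≤k))) (sym (joined-left (suc i) 1+i≤k))
          (at-adj w i 1+i≤k)
      by-cases (no 1+i≰k) =
        subst₂ (Adj G) (sym (joined-right i k≤i))
          (sym (trans (joined-right (suc i) (m≤n⇒m≤1+n k≤i)) (cong (at u) (+-∸-assoc 1 k≤i))))
          (at-adj u (i ∸ k) i∸k<l)
        where
        k≤i : k ≤ i
        k≤i = s≤s⁻¹ (≰⇒> 1+i≰k)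
        i∸k<l : i ∸ k < l
        i∸k<l = +-cancelˡ-< k (i ∸ k) l (subst (_< k + l) (sym (m+[n∸m]≡n k≤i)) i<k+l)

    walk : SeqWalk G x z (k + l)
    walk = seqWalk joined (trans (joined-left 0 z≤n) (at-start w))
      (trans (joined-right (k + l) (m≤m+n k l)) (trans (cong (at u) (m+n∸m≡n k l)) (at-end u))) adj

    avoids : ∀ {v} → Avoids v w → Avoids v u → Avoids v walk
    avoids w-avoids u-avoids i i≤k+l with i ≤? k
    ... | yes i≤k = w-avoids i i≤k
    ... | no  _   = u-avoids (i ∸ k) (subst (i ∸ k ≤_) (m+n∸m≡n k l) (∸-monoˡ-≤ k i≤k+l))

    nonBacktracking : NonBacktracking w → NonBacktracking u →
                      (∀ i → k ≡ suc i → 1 ≤ l → at w i ≢ at u 1) → NonBacktracking walk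
    nonBacktracking w-nb u-nb junction i 2+i≤k+l = by-cases (suc (suc i) ≤? k) (k ≤? i)
      where
      by-cases : Dec (suc (suc i) ≤ k) → Dec (k ≤ i) → joined i ≢ joined (suc (suc i))
      by-cases (yes 2+i≤k) _ back =
        w-nb i 2+i≤k (trans (sym (joined-left i (≤-trans (n≤1+n i) (<⇒≤ 2+i≤k))))
                        (trans back (joined-left (suc (suc i)) 2+i≤k)))
      by-cases (no _) (yes k≤i) back =
        u-nb (i ∸ k) 2+i∸k≤l (trans (sym (joined-right i k≤i))
          (trans back (trans (joined-right (suc (suc i)) (≤-trans k≤i (≤-trans (n≤1+n i) (n≤1+n (suc i)))))
                             (cong (at u) (+-∸-assoc 2 k≤i)))))
        where
        2+i∸k≤l : suc (suc (i ∸ k)) ≤ l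
        2+i∸k≤l = subst₂ _≤_ (+-∸-assoc 2 k≤i) (m+n∸m≡n k l) (∸-monoˡ-≤ k 2+i≤k+l)
      by-cases (no 2+i≰k) (no k≰i) back =
        junction i k≡1+i 1≤l (trans (sym (joined-left i (<⇒≤ i<k)))
          (trans back (trans (joined-right (suc (suc i)) (subst (_≤ suc (suc i)) (sym k≡1+i) (n≤1+n _)))
                             (cong (at u) (trans (cong (suc (suc i) ∸_) k≡1+i) (m+n∸n≡m 1 (suc i)))))))
        where
        i<k : i < k
        i<k = ≰⇒> k≰i
        k≡1+i : k ≡ suc i
        k≡1+i = ≤-antisym (s≤s⁻¹ (≰⇒> 2+i≰k)) i<k
        1≤l : 1 ≤ l
        1≤l = +-cancelˡ-≤ (suc i) 1 l
                (subst (_≤ suc i + l) (+-comm 1 (suc i)) (subst (λ j → suc (suc i) ≤ j + l) k≡1+i 2+i≤k+l))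

  infixr 5 _++_
  _++_ : ∀ {x y z k l} → SeqWalk G x y k → SeqWalk G y z l → SeqWalk G x z (k + l)
  w ++ u = Append.walk w u

  ++-avoids : ∀ {x y z k l v} (w : SeqWalk G x y k) (u : SeqWalk G y z l) →
              Avoids v w → Avoids v u → Avoids v (w ++ u)
  ++-avoids w u = Append.avoids w u

  ++-nonBacktracking : ∀ {x y z k l} (w : SeqWalk G x y k) (u : SeqWalk G y z l) →
                       NonBacktracking w → NonBacktracking u →
                       (∀ i → k ≡ suc i → 1 ≤ l → at w i ≢ at u 1) → NonBacktracking (w ++ u)
  ++-nonBacktracking w u = Append.nonBacktracking w u

  reverse-nonBacktracking : ∀ {x y k} (w : SeqWalk G x y k) → NonBacktracking w → NonBacktracking (reverse w)
  reverse-nonBacktracking {k = k} w w-nb i 2+i≤k back =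
    w-nb (k ∸ suc (suc i)) (subst (_≤ k) k∸i≡2+k∸[2+i] (m∸n≤m k i))
      (trans (sym back) (cong (at w) k∸i≡2+k∸[2+i]))
    where
    k∸i≡2+k∸[2+i] : k ∸ i ≡ suc (suc (k ∸ suc (suc i)))
    k∸i≡2+k∸[2+i] = +-∸-assoc 2 2+i≤k

  remove-backtrack : ∀ {x y k} (w : SeqWalk G x y k) i l → k ≡ suc (suc i) + l →
                     at w i ≡ at w (suc (suc i)) → SeqWalk G x y (i + l)
  remove-backtrack w i l k≡2+i+l back = take w i i≤k ++ cast-start (sym back) (drop w (suc (suc i)) l k≡2+i+l)
    where
    i≤k : i ≤ _
    i≤k = ≤-trans (≤-trans (n≤1+n i) (n≤1+n (suc i))) (≤-trans (m≤m+n (suc (suc i)) l) (≤-reflexive (sym k≡2+i+l)))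

  toWalk : ∀ {x y k} → SeqWalk G x y k → Walk G x y k
  toWalk {k = k} w = record
    { vtx   = λ j → at w (toℕ j)
    ; start = at-start w
    ; end   = trans (cong (at w) (toℕ-fromℕ k)) (at-end w)
    ; step  = λ i → subst (λ j → Adj G (at w j) (at w (suc (toℕ i)))) (sym (toℕ-inject₁ i))
                      (at-adj w (toℕ i) (toℕ<n i))
    }

  toWalk-avoids : ∀ {x y k v} (w : SeqWalk G x y k) → Avoids v w → ∀ i → vtx (toWalk w) i ≢ v
  toWalk-avoids w w-avoids i = w-avoids (toℕ i) (s≤s⁻¹ (toℕ<n i))

  module FromWalk {x y k} (w : Walk G x y k) where

    vertex : ℕ → Fin n
    vertex i with i <? suc k
    ... | yes i<1+k = vtx w (fromℕ< i<1+k)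
    ... | no _      = y

    vertex-toℕ : ∀ (j : Fin (suc k)) → vertex (toℕ j) ≡ vtx w j
    vertex-toℕ j with toℕ j <? suc k
    ... | yes j<1+k = cong (vtx w) (toℕ-injective (toℕ-fromℕ< j<1+k))
    ... | no  j≮1+k = contradiction (toℕ<n j) j≮1+k

    walk : SeqWalk G x y k
    walk = seqWalk vertex (trans (vertex-toℕ zero) (start w))
      (trans (cong vertex (sym (toℕ-fromℕ k))) (trans (vertex-toℕ (fromℕ k)) (end w)))
      (λ i i<k → let j = fromℕ< i<k in
        subst₂ (λ a b → Adj G (vertex a) (vertex b))
          (trans (toℕ-inject₁ j) (toℕ-fromℕ< i<k)) (cong suc (toℕ-fromℕ< i<k))
          (subst₂ (Adj G) (sym (vertex-toℕ (inject₁ j))) (sym (vertex-toℕ (suc j))) (step w j)))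

  fromWalk : ∀ {x y k} → Walk G x y k → SeqWalk G x y k
  fromWalk = FromWalk.walk

  toDist : ∀ {x y k} → ShortestWalk G x y k → Dist G x y k
  toDist (w , shortest) = toWalk w , λ j j<k u → shortest j j<k (fromWalk u)

  shortestWalk-self : ∀ x → ShortestWalk G x x 0
  shortestWalk-self x = stay x , λ _ ()

  shortestWalk-0⇒≡ : ∀ {x y} → ShortestWalk G x y 0 → x ≡ y
  shortestWalk-0⇒≡ (w , _) = trans (sym (at-start w)) (at-end w)

  -- Adjacency is not assumed decidable, so a shortest walk exists only in the double-negation sense.
  ¬¬-shortestWalk : ∀ {x y k} → SeqWalk G x y k → ¬ ¬ (∃[ d ] ShortestWalk G x y d)
  ¬¬-shortestWalk {x} {y} {k} = <-rec (λ k → SeqWalk G x y k → ¬ ¬ (∃[ d ] ShortestWalk G x y d))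
    (λ k shorter w no-shortest → no-shortest (k , w , λ j j<k u → shorter j<k u no-shortest)) k

  module ClosedWalk {x L} (w : SeqWalk G x x L) (nonBacktracking : NonBacktracking w) where

    private
      f = at w

    Repeat : ℕ → ℕ → Set
    Repeat i d = ∃[ a ] a < d × ∃[ e ] e < d × (a + suc e < d × f (i + a) ≡ f (i + (a + suc e)))

    repeat? : ∀ i d → Dec (Repeat i d)
    repeat? i d = anyUpTo? (λ a → anyUpTo? (λ e → (a + suc e <? d) ×-dec (f (i + a) ≟ᶠ f (i + (a + suc e)))) d) d

    repeat-at : ∀ {i d a b} → a < b → b < d → f (i + a) ≡ f (i + b) → Repeat i d
    repeat-at {i} {d} {a} {b} a<b b<d fa≡fb =
      a , <-trans a<b b<d , b ∸ suc a , ≤-<-trans (m∸n≤m b (suc a)) b<d ,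
      subst (_< d) (sym b≡) b<d , trans fa≡fb (cong (λ j → f (i + j)) (sym b≡))
      where
      b≡ : a + suc (b ∸ suc a) ≡ b
      b≡ = trans (+-suc a (b ∸ suc a)) (m+[n∸m]≡n a<b)

    no-repeat⇒injective : ∀ {i d} → ¬ Repeat i d → ∀ a b → a < d → b < d → f (i + a) ≡ f (i + b) → a ≡ b
    no-repeat⇒injective no-repeat a b a<d b<d fa≡fb with <-cmp a b
    ... | tri< a<b _ _ = contradiction (repeat-at a<b b<d fa≡fb) no-repeat
    ... | tri≈ _ a≡b _ = a≡b
    ... | tri> _ _ b<a = contradiction (repeat-at b<a a<d (sym fa≡fb)) no-repeat

    injective-window⇒cycle : ∀ i m → i + suc (suc (suc m)) ≤ L → f i ≡ f (i + suc (suc (suc m))) →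
      (∀ a b → a < suc (suc (suc m)) → b < suc (suc (suc m)) → f (i + a) ≡ f (i + b) → a ≡ b) →
      Cycle G (suc (suc (suc m)))
    injective-window⇒cycle i m i+g≤L closes injective = record
      { m     = m
      ; len   = refl
      ; cv    = λ j → f (i + toℕ j)
      ; inj   = λ {a} {b} fa≡fb → toℕ-injective (injective (toℕ a) (toℕ b) (toℕ<n a) (toℕ<n b) fa≡fb)
      ; step  = λ j → subst₂ (λ a b → Adj G (f (i + a)) (f b)) (sym (toℕ-inject₁ j)) (sym (+-suc i (toℕ j)))
                        (at-adj w (i + toℕ j) (<-≤-trans (+-monoʳ-< i (<-trans (toℕ<n j) (n<1+n _))) i+g≤L))
      ; close = subst₂ (λ a b → Adj G (f (i + a)) b) (sym (toℕ-fromℕ _))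
                  (trans (cong f (sym (+-suc i _))) (trans (sym closes) (cong f (sym (+-identityʳ i)))))
                  (at-adj w (i + suc (suc m)) (<-≤-trans (+-monoʳ-< i (n<1+n _)) i+g≤L))
      }

    -- A closed subwalk without inner repetitions is a cycle; its length is at least 3 because
    -- the graph is loopless and the walk does not backtrack.
    window⇒cycle : ∀ d i → 0 < d → i + d ≤ L → f i ≡ f (i + d) →
                   (∀ a b → a < d → b < d → f (i + a) ≡ f (i + b) → a ≡ b) → ∃[ k ] (k ≤ d × Cycle G k)
    window⇒cycle 1 i _ i+1≤L loop _ =
      ⊥-elim (irrefl G (subst (Adj G (f i)) (trans (cong f (+-comm 1 i)) (sym loop))
                          (at-adj w i (subst (_≤ L) (+-comm i 1) i+1≤L))))
    window⇒cycle 2 i _ i+2≤L backtrack _ =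
      ⊥-elim (nonBacktracking i (subst (_≤ L) (+-comm i 2) i+2≤L) (trans backtrack (cong f (+-comm i 2))))
    window⇒cycle (suc (suc (suc m))) i _ i+d≤L closes injective =
      suc (suc (suc m)) , ≤-refl , injective-window⇒cycle i m i+d≤L closes injective

    closed-window⇒cycle : ∀ d i → 0 < d → i + d ≤ L → f i ≡ f (i + d) → ∃[ k ] (k ≤ d × Cycle G k)
    closed-window⇒cycle = <-rec _ shrink
      where
      shrink : ∀ d → (∀ {d′} → d′ < d → ∀ i → 0 < d′ → i + d′ ≤ L → f i ≡ f (i + d′) → ∃[ k ] (k ≤ d′ × Cycle G k)) →
             ∀ i → 0 < d → i + d ≤ L → f i ≡ f (i + d) → ∃[ k ] (k ≤ d × Cycle G k)
      shrink d shorter i 0<d i+d≤L closes with repeat? i d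
      ... | no no-repeat = window⇒cycle d i 0<d i+d≤L closes (no-repeat⇒injective no-repeat)
      ... | yes (a , _ , e , _ , a+1+e<d , repeats) with
            shorter (≤-<-trans (m≤n+m (suc e) a) a+1+e<d) (i + a) (s≤s z≤n)
              (subst (_≤ L) (sym (+-assoc i a (suc e))) (≤-trans (+-monoʳ-≤ i (<⇒≤ a+1+e<d)) i+d≤L))
              (trans repeats (cong f (sym (+-assoc i a (suc e)))))
      ...   | k , k≤1+e , cycle = k , ≤-trans k≤1+e (≤-trans (m≤n+m (suc e) a) (<⇒≤ a+1+e<d)) , cycle

  closed-walk⇒cycle : ∀ {x L} (w : SeqWalk G x x L) → NonBacktracking w → 0 < L → ∃[ k ] (k ≤ L × Cycle G k)
  closed-walk⇒cycle {L = L} w nonBacktracking 0<L =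
    ClosedWalk.closed-window⇒cycle w nonBacktracking L 0 0<L ≤-refl (trans (at-start w) (sym (at-end w)))

ReachableAvoiding : ∀ {n} (G : Graph n) → Fin n → Fin n → Fin n → Set
ReachableAvoiding G v x y = ∃[ k ] Σ (SeqWalk G x y k) (Avoids v)

module _ {n : ℕ} {G : Graph n} {v : Fin n} where

  reachable-trans : ∀ {x y z} → ReachableAvoiding G v x y → ReachableAvoiding G v y z → ReachableAvoiding G v x z
  reachable-trans (k , w , w-avoids) (l , u , u-avoids) = k + l , w ++ u , ++-avoids w u w-avoids u-avoids

  reachable-sym : ∀ {x y} → ReachableAvoiding G v x y → ReachableAvoiding G v y x
  reachable-sym (k , w , w-avoids) = k , reverse w , reverse-avoids w w-avoids

  reachable⇒walkAvoiding : ∀ {x y} → ReachableAvoiding G v x y → ∃[ k ] WalkAvoiding G v x y k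
  reachable⇒walkAvoiding (k , w , w-avoids) = k , toWalk w , toWalk-avoids w w-avoids

  reachable-refl : ∀ {x} → x ≢ v → ReachableAvoiding G v x x
  reachable-refl {x} x≢v = 0 , stay x , λ _ _ → x≢v

  edge-reachable : ∀ {x y} → Adj G x y → x ≢ v → y ≢ v → ReachableAvoiding G v x y
  edge-reachable xy x≢v y≢v = 1 , edge xy , λ
    { zero          _        → x≢v
    ; (suc zero)    _        → y≢v
    ; (suc (suc _)) (s≤s ())
    }

  walk-into⇒reachable-neighbour : ∀ {z k} → z ≢ v → SeqWalk G z v k → ∃[ x ] (Adj G x v × ReachableAvoiding G v z x)
  walk-into⇒reachable-neighbour {k = zero} z≢v w = contradiction (trans (sym (at-start w)) (at-end w)) z≢v
  walk-into⇒reachable-neighbour {z} {suc k} z≢v w with at w 1 ≟ᶠ v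
  ... | yes w₁≡v = z , subst (Adj G z) w₁≡v (first-edge w) , reachable-refl z≢v
  ... | no w₁≢v with walk-into⇒reachable-neighbour w₁≢v (drop w 1 k refl)
  ...   | x , x-v , w₁⇝x = x , x-v , reachable-trans (edge-reachable (first-edge w) z≢v w₁≢v) w₁⇝x

  unreachable⇒walk-meets : ∀ {z y u ℓ} → ReachableAvoiding G v z y → y ≢ v → ¬ ReachableAvoiding G v z u →
                           (w : SeqWalk G u y ℓ) → ∃[ i ] (i < ℓ × at w i ≡ v)
  unreachable⇒walk-meets {ℓ = ℓ} z⇝y y≢v z⇝̸u w with anyUpTo? (λ i → at w i ≟ᶠ v) ℓ
  ... | yes meets = meets
  ... | no misses = contradiction (reachable-trans z⇝y (reachable-sym (ℓ , w , avoids))) z⇝̸u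
    where
    avoids : Avoids v w
    avoids i i≤ℓ with m≤n⇒m<n∨m≡n i≤ℓ
    ... | inj₁ i<ℓ  = λ wᵢ≡v → misses (i , i<ℓ , wᵢ≡v)
    ... | inj₂ refl = λ wℓ≡v → y≢v (trans (sym (at-end w)) wℓ≡v)

cycle-length≥3 : ∀ {n} {G : Graph n} {k} → Cycle G k → 3 ≤ k
cycle-length≥3 c = subst (3 ≤_) (sym (Cycle.len c)) (s≤s (s≤s (s≤s z≤n)))

cycle-length≤order : ∀ {n} {G : Graph n} {k} → Cycle G k → k ≤ n
cycle-length≤order {n} c = subst (_≤ n) (sym (Cycle.len c)) (injective⇒≤ (Cycle.inj c))

-- A cycle of length g, unrolled to the g-periodic sequence of vertices C : ℕ → Fin n.
module CycleSeq {n : ℕ} {G : Graph n} {k : ℕ} (c : Cycle G k) where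

  open Cycle c using (m; cv; inj) renaming (step to cv-step; close to cv-close)

  g : ℕ
  g = suc (suc (suc m))

  C : ℕ → Fin n
  C x = cv (fromℕ< (m%n<n x g))

  private
    cv-fromℕ< : ∀ {a} (a<g : a < g) (j : Fin g) → toℕ j ≡ a → cv (fromℕ< a<g) ≡ cv j
    cv-fromℕ< a<g j j≡a = cong cv (toℕ-injective (trans (toℕ-fromℕ< a<g) (sym j≡a)))

  C-cong-% : ∀ {x y} → x % g ≡ y % g → C x ≡ C y
  C-cong-% {x} {y} x≡y = cv-fromℕ< (m%n<n x g) (fromℕ< (m%n<n y g)) (trans (toℕ-fromℕ< (m%n<n y g)) (sym x≡y))

  C-injective-% : ∀ {x y} → C x ≡ C y → x % g ≡ y % g
  C-injective-% {x} {y} Cx≡Cy =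
    trans (sym (toℕ-fromℕ< (m%n<n x g))) (trans (cong toℕ (inj Cx≡Cy)) (toℕ-fromℕ< (m%n<n y g)))

  C-% : ∀ x → C (x % g) ≡ C x
  C-% x = C-cong-% {x % g} {x} (m%n%n≡m%n x g)

  C-periodic : ∀ x → C (x + g) ≡ C x
  C-periodic x = C-cong-% {x + g} {x} ([m+n]%n≡m%n x g)

  C-periodic* : ∀ x q → C (x + q * g) ≡ C x
  C-periodic* x q = C-cong-% {x + q * g} {x} ([m+kn]%n≡m%n x q g)

  C-adj : ∀ x → Adj G (C x) (C (suc x))
  C-adj x with m<1+n⇒m<n∨m≡n (s≤s (m%n<n x g))
  ... | inj₁ 1+r<g = subst₂ (Adj G)
        (sym (cv-fromℕ< (m%n<n x g) (inject₁ i) (trans (toℕ-inject₁ i) (toℕ-fromℕ< (s≤s⁻¹ 1+r<g)))))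
        (sym (cv-fromℕ< (m%n<n (suc x) g) (suc i)
               (trans (cong suc (toℕ-fromℕ< (s≤s⁻¹ 1+r<g))) (sym (trans 1+x%g (m<n⇒m%n≡m 1+r<g))))))
        (cv-step i)
    where
    i = fromℕ< (s≤s⁻¹ 1+r<g)
    1+x%g : suc x % g ≡ suc (x % g) % g
    1+x%g = %-distribˡ-+ 1 x g
  ... | inj₂ 1+r≡g = subst₂ (Adj G)
        (sym (cv-fromℕ< (m%n<n x g) (fromℕ (suc (suc m))) (trans (toℕ-fromℕ _) (cong pred (sym 1+r≡g)))))
        (sym (cv-fromℕ< (m%n<n (suc x) g) zero (sym (trans 1+x%g (trans (cong (_% g) 1+r≡g) (n%n≡0 g))))))
        cv-close
    where
    1+x%g : suc x % g ≡ suc (x % g) % g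
    1+x%g = %-distribˡ-+ 1 x g

  C-window : ∀ i d → d < g → C i ≡ C (i + d) → d ≡ 0
  C-window i d d<g Ci≡Ci+d = by-cases (r + d <? g)
    where
    r = i % g
    r≡[r+d]% : r ≡ (r + d) % g
    r≡[r+d]% = trans (C-injective-% {i} {i + d} Ci≡Ci+d)
                 (trans (%-distribˡ-+ i d g) (cong (λ e → (r + e) % g) (m<n⇒m%n≡m d<g)))
    by-cases : Dec (r + d < g) → d ≡ 0
    by-cases (yes r+d<g) = +-cancelˡ-≡ r d 0 (sym (trans (+-identityʳ r) (trans r≡[r+d]% (m<n⇒m%n≡m r+d<g))))
    by-cases (no r+d≮g) = contradiction d≡g (<⇒≢ d<g)
      where
      g≤r+d : g ≤ r + d
      g≤r+d = ≮⇒≥ r+d≮g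
      r+d∸g<g : r + d ∸ g < g
      r+d∸g<g = subst (r + d ∸ g <_) (m+n∸n≡m g g) (∸-monoˡ-< (+-mono-< (m%n<n i g) d<g) g≤r+d)
      r≡r+d∸g : r ≡ r + d ∸ g
      r≡r+d∸g = trans r≡[r+d]% (trans (sym (m≤n⇒[n∸m]%m≡n%m g≤r+d)) (m<n⇒m%n≡m r+d∸g<g))
      d≡g : d ≡ g
      d≡g = +-cancelˡ-≡ r d g (trans (sym (m∸n+n≡m g≤r+d)) (cong (_+ g) (sym r≡r+d∸g)))

  C-injective-≤ : ∀ s {a b} → a ≤ b → b < g → C (s + a) ≡ C (s + b) → a ≡ b
  C-injective-≤ s {a} {b} a≤b b<g Ca≡Cb =
    sym (trans (sym (m+[n∸m]≡n a≤b)) (trans (cong (a +_) b∸a≡0) (+-identityʳ a)))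
    where
    b∸a≡0 : b ∸ a ≡ 0
    b∸a≡0 = C-window (s + a) (b ∸ a) (≤-<-trans (m∸n≤m b a) b<g)
      (trans Ca≡Cb (cong C (trans (cong (s +_) (sym (m+[n∸m]≡n a≤b))) (sym (+-assoc s a (b ∸ a))))))

  C-injective : ∀ s {a b} → a < g → b < g → C (s + a) ≡ C (s + b) → a ≡ b
  C-injective s {a} {b} a<g b<g Ca≡Cb with ≤-total a b
  ... | inj₁ a≤b = C-injective-≤ s a≤b b<g Ca≡Cb
  ... | inj₂ b≤a = sym (C-injective-≤ s b≤a a<g (sym Ca≡Cb))

  OnCycle : Fin n → Set
  OnCycle y = ∃[ e ] (e < g × y ≡ C e)

  onCycle? : ∀ y → Dec (OnCycle y)
  onCycle? y = anyUpTo? (λ e → y ≟ᶠ C e) g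

  C-onCycle : ∀ x → OnCycle (C x)
  C-onCycle x = x % g , m%n<n x g , sym (C-% x)

  C-offset : ∀ s x → ∃[ e ] (e < g × C x ≡ C (s + e))
  C-offset zero x = C-onCycle x
  C-offset (suc s) x with C-offset s x
  ... | suc e , 1+e<g , Cx≡ = e , <-trans (n<1+n e) 1+e<g , trans Cx≡ (cong C (+-suc s e))
  ... | zero  , _     , Cx≡ = suc (suc m) , n<1+n _ ,
        trans Cx≡ (trans (cong C (+-identityʳ s)) (trans (sym (C-periodic s)) (cong C (+-suc s (suc (suc m))))))

  arc : ∀ s k → SeqWalk G (C s) (C (s + k)) k
  arc s k = seqWalk (λ i → C (s + i)) (cong C (+-identityʳ s)) refl
    (λ i _ → subst (λ j → Adj G (C (s + i)) (C j)) (sym (+-suc s i)) (C-adj (s + i)))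


module Isometry {n : ℕ} {G : Graph n} {k : ℕ} (girth : Girth G k) where

  open CycleSeq (proj₁ girth) public

  no-cycle-shorter-than-g : ∀ j → j < g → ¬ Cycle G j
  no-cycle-shorter-than-g j j<g = proj₂ girth j (subst (j <_) (sym (Cycle.len (proj₁ girth))) j<g)

  arc-nonBacktracking : ∀ s k → NonBacktracking (arc s k)
  arc-nonBacktracking s k i _ back =
    contradiction (C-window (s + i) 2 (s≤s (s≤s (s≤s z≤n))) (trans back (cong C s+[2+i]≡s+i+2))) λ ()
    where
    s+[2+i]≡s+i+2 : s + suc (suc i) ≡ s + i + 2
    s+[2+i]≡s+i+2 = sym (trans (+-assoc s i 2) (cong (s +_) (+-comm i 2)))

  InteriorOffCycle : ∀ {x y ℓ} → SeqWalk G x y ℓ → Set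
  InteriorOffCycle {ℓ = ℓ} w = ∀ r → 0 < r → r < ℓ → ¬ OnCycle (at w r)

  -- Closing w with the arc back gives a non-backtracking closed walk of length ℓ + M < g.
  no-short-detour : ∀ s M ℓ (w : SeqWalk G (C s) (C (s + M)) ℓ) →
                    NonBacktracking w → InteriorOffCycle w → ℓ < M → ℓ + M < g → ⊥
  no-short-detour s M ℓ w w-nb w-off ℓ<M ℓ+M<g
    with closed-walk⇒cycle (w ++ reverse (arc s M)) nonBacktracking (<-≤-trans (≤-<-trans z≤n ℓ<M) (m≤n+m M ℓ))
    where
    junction : ∀ i → ℓ ≡ suc i → 1 ≤ M → at w i ≢ C (s + (M ∸ 1))
    junction zero ℓ≡1 _ w₀≡ =
      contradiction (C-window s (M ∸ 1) (≤-<-trans (m∸n≤m M 1) (≤-<-trans (m≤n+m M ℓ) ℓ+M<g))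
                      (trans (sym (at-start w)) w₀≡))
                    (m<n⇒n≢0 (m<n⇒0<n∸m (subst (_< M) ℓ≡1 ℓ<M)))
    junction (suc i) ℓ≡2+i _ wᵢ≡ =
      w-off (suc i) (s≤s z≤n) (subst (suc i <_) (sym ℓ≡2+i) (n<1+n _)) (subst OnCycle (sym wᵢ≡) (C-onCycle (s + (M ∸ 1))))
    nonBacktracking : NonBacktracking (w ++ reverse (arc s M))
    nonBacktracking = ++-nonBacktracking w (reverse (arc s M)) w-nb
      (reverse-nonBacktracking (arc s M) (arc-nonBacktracking s M)) junction
  ... | j , j≤ℓ+M , cycle = no-cycle-shorter-than-g j (≤-<-trans j≤ℓ+M ℓ+M<g) cycle

  Near : ℕ → Fin n → ℕ → Set
  Near s y ℓ = ∃[ t ] (C t ≡ y × s ≤ t + ℓ × t ≤ s + ℓ)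

  near-mono : ∀ {s y ℓ ℓ′} → ℓ ≤ ℓ′ → Near s y ℓ → Near s y ℓ′
  near-mono ℓ≤ℓ′ (t , Ct≡y , s≤t+ℓ , t≤s+ℓ) =
    t , Ct≡y , ≤-trans s≤t+ℓ (+-monoʳ-≤ t ℓ≤ℓ′) , ≤-trans t≤s+ℓ (+-monoʳ-≤ _ ℓ≤ℓ′)

  near-trans : ∀ {s z y r l} (near : Near s z r) → Near (proj₁ near) y l → Near s y (r + l)
  near-trans {s} {r = r} {l} (t₁ , _ , s≤t₁+r , t₁≤s+r) (t₂ , Ct₂≡y , t₁≤t₂+l , t₂≤t₁+l) =
    t₂ , Ct₂≡y , s≤t₂+r+l , t₂≤s+r+l
    where
    open ≤-Reasoning
    s≤t₂+r+l : s ≤ t₂ + (r + l)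
    s≤t₂+r+l = begin
      s             ≤⟨ s≤t₁+r ⟩
      t₁ + r        ≤⟨ +-monoˡ-≤ r t₁≤t₂+l ⟩
      t₂ + l + r    ≡⟨ +-assoc t₂ l r ⟩
      t₂ + (l + r)  ≡⟨ cong (t₂ +_) (+-comm l r) ⟩
      t₂ + (r + l)  ∎
    t₂≤s+r+l : t₂ ≤ s + (r + l)
    t₂≤s+r+l = begin
      t₂            ≤⟨ t₂≤t₁+l ⟩
      t₁ + l        ≤⟨ +-monoˡ-≤ l t₁≤s+r ⟩
      s + r + l     ≡⟨ +-assoc s r l ⟩
      s + (r + l)   ∎

  nonBacktracking-walk⇒near : ∀ {s y ℓ} → ℓ + g ≤ s → (w : SeqWalk G (C s) y ℓ) →
                            NonBacktracking w → InteriorOffCycle w → OnCycle y → Near s y ℓ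
  nonBacktracking-walk⇒near {s} {y} {ℓ} ℓ+g≤s w w-nb w-off (e₀ , _ , y≡Ce₀) with C-offset s e₀
  ... | e , e<g , Ce₀≡ = by-cases (e ≤? ℓ) (g ∸ e ≤? ℓ)
    where
    y≡ : y ≡ C (s + e)
    y≡ = trans y≡Ce₀ Ce₀≡
    by-cases : Dec (e ≤ ℓ) → Dec (g ∸ e ≤ ℓ) → Near s y ℓ
    by-cases (yes e≤ℓ) _ = s + e , sym y≡ , ≤-trans (m≤m+n s e) (m≤m+n (s + e) ℓ) , +-monoʳ-≤ s e≤ℓ
    by-cases (no _) (yes g∸e≤ℓ) = s ∸ (g ∸ e) , Ct≡y , s≤t+ℓ , ≤-trans (m∸n≤m s (g ∸ e)) (m≤m+n s ℓ)
      where
      g∸e≤s : g ∸ e ≤ s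
      g∸e≤s = ≤-trans (m∸n≤m g e) (≤-trans (m≤n+m g ℓ) ℓ+g≤s)
      Ct≡y : C (s ∸ (g ∸ e)) ≡ y
      Ct≡y = begin
        C (s ∸ (g ∸ e))                   ≡⟨ sym (C-periodic (s ∸ (g ∸ e))) ⟩
        C (s ∸ (g ∸ e) + g)               ≡⟨ cong (λ j → C (s ∸ (g ∸ e) + j)) (sym (m∸n+n≡m (<⇒≤ e<g))) ⟩
        C (s ∸ (g ∸ e) + (g ∸ e + e))     ≡⟨ cong C (sym (+-assoc (s ∸ (g ∸ e)) (g ∸ e) e)) ⟩
        C (s ∸ (g ∸ e) + (g ∸ e) + e)     ≡⟨ cong (λ j → C (j + e)) (m∸n+n≡m g∸e≤s) ⟩
        C (s + e)                         ≡⟨ sym y≡ ⟩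
        y                                 ∎
        where open ≡-Reasoning
      s≤t+ℓ : s ≤ s ∸ (g ∸ e) + ℓ
      s≤t+ℓ = subst (_≤ s ∸ (g ∸ e) + ℓ) (m∸n+n≡m g∸e≤s) (+-monoʳ-≤ (s ∸ (g ∸ e)) g∸e≤ℓ)
    by-cases (no e≰ℓ) (no g∸e≰ℓ) =
      ⊥-elim (no-short-detour s e ℓ (cast-end y≡ w) w-nb w-off (≰⇒> e≰ℓ)
               (subst (ℓ + e <_) (m∸n+n≡m (<⇒≤ e<g)) (+-monoˡ-< e (≰⇒> g∸e≰ℓ))))

  -- The cycle is isometric, in the following form (the offset ℓ + g ≤ s keeps all positions in ℕ).
  walk⇒near : ∀ ℓ {s y} → ℓ + g ≤ s → SeqWalk G (C s) y ℓ → OnCycle y → Near s y ℓ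
  walk⇒near = <-rec (λ ℓ → ∀ {s y} → ℓ + g ≤ s → SeqWalk G (C s) y ℓ → OnCycle y → Near s y ℓ) induct
    where
    induct : ∀ ℓ → (∀ {ℓ′} → ℓ′ < ℓ → ∀ {s y} → ℓ′ + g ≤ s → SeqWalk G (C s) y ℓ′ → OnCycle y → Near s y ℓ′) →
             ∀ {s y} → ℓ + g ≤ s → SeqWalk G (C s) y ℓ → OnCycle y → Near s y ℓ
    induct ℓ shorter {s} {y} ℓ+g≤s w y-on with anyUpTo? (λ r → (0 <? r) ×-dec onCycle? (at w r)) ℓ
    ... | yes (r , r<ℓ , 0<r , wᵣ-on) = subst (Near s y) (sym ℓ≡r+l) (near-trans near₁ near₂)
      where
      l = ℓ ∸ r
      ℓ≡r+l : ℓ ≡ r + l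
      ℓ≡r+l = sym (m+[n∸m]≡n (<⇒≤ r<ℓ))
      near₁ : Near s (at w r) r
      near₁ = shorter r<ℓ (≤-trans (+-monoˡ-≤ g (<⇒≤ r<ℓ)) ℓ+g≤s) (take w r (<⇒≤ r<ℓ)) wᵣ-on
      t₁ = proj₁ near₁
      l+g≤t₁ : l + g ≤ t₁
      l+g≤t₁ = +-cancelˡ-≤ r (l + g) t₁ (subst₂ _≤_ (+-assoc r l g) (+-comm t₁ r)
                 (≤-trans (subst (λ j → j + g ≤ s) ℓ≡r+l ℓ+g≤s) (proj₁ (proj₂ (proj₂ near₁)))))
      near₂ : Near t₁ y l
      near₂ = shorter (subst (l <_) (sym ℓ≡r+l) (m<n+m l 0<r)) l+g≤t₁
                (cast-start (sym (proj₁ (proj₂ near₁))) (drop w r l ℓ≡r+l)) y-on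
    ... | no no-interior-hit with anyUpTo? (λ i → (suc (suc i) ≤? ℓ) ×-dec (at w i ≟ᶠ at w (suc (suc i)))) ℓ
    ...   | yes (i , _ , 2+i≤ℓ , back) =
            near-mono i+l≤ℓ (shorter i+l<ℓ (≤-trans (+-monoˡ-≤ g i+l≤ℓ) ℓ+g≤s)
                               (remove-backtrack w i l ℓ≡2+i+l back) y-on)
      where
      l = ℓ ∸ suc (suc i)
      ℓ≡2+i+l : ℓ ≡ suc (suc i) + l
      ℓ≡2+i+l = sym (m+[n∸m]≡n 2+i≤ℓ)
      i+l<ℓ : i + l < ℓ
      i+l<ℓ = subst (i + l <_) (sym ℓ≡2+i+l) (+-monoˡ-< l (≤-trans (n<1+n i) (n≤1+n (suc i))))
      i+l≤ℓ : i + l ≤ ℓ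
      i+l≤ℓ = <⇒≤ i+l<ℓ
    ...   | no no-backtrack = nonBacktracking-walk⇒near ℓ+g≤s w
            (λ i 2+i≤ℓ back → no-backtrack (i , <-trans (n<1+n i) 2+i≤ℓ , 2+i≤ℓ , back))
            (λ r 0<r r<ℓ wᵣ-on → no-interior-hit (r , r<ℓ , 0<r , wᵣ-on))
            y-on

  cycDist : ℕ → ℕ
  cycDist k = k ⊓ (g ∸ k)

  near⇒cycDist≤ : ∀ {s k ℓ} → k < g → Near s (C (s + k)) ℓ → cycDist k ≤ ℓ
  near⇒cycDist≤ {s} {k} {ℓ} k<g (t , Ct≡ , s≤t+ℓ , t≤s+ℓ) with ≤-total s t
  ... | inj₁ s≤t = ≤-trans (m⊓n≤m k (g ∸ k)) (by-cases (≤-total u k))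
    where
    u = t ∸ s
    t≡s+u : t ≡ s + u
    t≡s+u = sym (m+[n∸m]≡n s≤t)
    u≤ℓ : u ≤ ℓ
    u≤ℓ = +-cancelˡ-≤ s u ℓ (subst (_≤ s + ℓ) t≡s+u t≤s+ℓ)
    by-cases : u ≤ k ⊎ k ≤ u → k ≤ ℓ
    by-cases (inj₂ k≤u) = ≤-trans k≤u u≤ℓ
    by-cases (inj₁ u≤k) = subst (_≤ ℓ) (C-injective-≤ s u≤k k<g (trans (cong C (sym t≡s+u)) Ct≡)) u≤ℓ
  ... | inj₂ t≤s = by-cases (u + k <? g)
    where
    u = s ∸ t
    s≡t+u : s ≡ t + u
    s≡t+u = sym (m+[n∸m]≡n t≤s)
    u≤ℓ : u ≤ ℓ
    u≤ℓ = +-cancelˡ-≤ t u ℓ (subst (_≤ t + ℓ) s≡t+u s≤t+ℓ)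
    Ct≡Ct+u+k : C t ≡ C (t + (u + k))
    Ct≡Ct+u+k = trans Ct≡ (cong C (trans (cong (_+ k) s≡t+u) (+-assoc t u k)))
    by-cases : Dec (u + k < g) → cycDist k ≤ ℓ
    by-cases (yes u+k<g) = subst (λ j → cycDist j ≤ ℓ) (sym (m+n≡0⇒n≡0 u (C-window t (u + k) u+k<g Ct≡Ct+u+k))) z≤n
    by-cases (no u+k≮g) =
      ≤-trans (m⊓n≤n k (g ∸ k)) (≤-trans (subst (g ∸ k ≤_) (m+n∸n≡m u k) (∸-monoˡ-≤ k (≮⇒≥ u+k≮g))) u≤ℓ)

  cycDist-≤-length : ∀ j k {ℓ} → k < g → SeqWalk G (C j) (C (j + k)) ℓ → cycDist k ≤ ℓ
  cycDist-≤-length j k {ℓ} k<g w = near⇒cycDist≤ k<g (walk⇒near ℓ ℓ+g≤s shifted (C-onCycle (s + k)))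
    where
    q = ℓ + g
    s = j + q * g
    ℓ+g≤s : ℓ + g ≤ s
    ℓ+g≤s = ≤-trans (m≤m*n q g) (m≤n+m (q * g) j)
    shifted : SeqWalk G (C s) (C (s + k)) ℓ
    shifted = cast-start (sym (C-periodic* j q))
      (cast-end (trans (sym (C-periodic* (j + k) q))
        (cong C (trans (+-assoc j k (q * g)) (trans (cong (j +_) (+-comm k (q * g))) (sym (+-assoc j (q * g) k))))))
        w)

  shortestWalk-on-cycle : ∀ j k → k < g → ShortestWalk G (C (j + k)) (C j) (cycDist k)
  shortestWalk-on-cycle j k k<g =
    reverse shorter-arc , λ ℓ ℓ<cycDist w → <⇒≱ ℓ<cycDist (cycDist-≤-length j k k<g (reverse w))
    where
    shorter-arc : SeqWalk G (C j) (C (j + k)) (cycDist k)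
    shorter-arc with ≤-total k (g ∸ k)
    ... | inj₁ k≤g∸k = cast-length (sym (m≤n⇒m⊓n≡m k≤g∸k)) (arc j k)
    ... | inj₂ g∸k≤k = cast-length (sym (m≥n⇒m⊓n≡n g∸k≤k))
      (cast-start wraps (reverse (arc (j + k) (g ∸ k))))
      where
      wraps : C (j + k + (g ∸ k)) ≡ C j
      wraps = trans (cong C (trans (+-assoc j k (g ∸ k)) (cong (j +_) (m+[n∸m]≡n (<⇒≤ k<g))))) (C-periodic j)

  cycDist-≡ : ∀ {k k′} → k < g → k′ < g → cycDist k ≡ cycDist k′ → k ≡ k′ ⊎ k + k′ ≡ g
  cycDist-≡ {k} {k′} k<g k′<g same with ≤-total k (g ∸ k) | ≤-total k′ (g ∸ k′)
  ... | inj₁ k≤ | inj₁ k′≤ = inj₁ (trans (sym (m≤n⇒m⊓n≡m k≤)) (trans same (m≤n⇒m⊓n≡m k′≤)))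
  ... | inj₁ k≤ | inj₂ k′≥ =
        inj₂ (trans (cong (_+ k′) (trans (sym (m≤n⇒m⊓n≡m k≤)) (trans same (m≥n⇒m⊓n≡n k′≥)))) (m∸n+n≡m (<⇒≤ k′<g)))
  ... | inj₂ k≥ | inj₁ k′≤ =
        inj₂ (trans (cong (k +_) (trans (sym (m≤n⇒m⊓n≡m k′≤)) (trans (sym same) (m≥n⇒m⊓n≡n k≥)))) (m+[n∸m]≡n (<⇒≤ k<g)))
  ... | inj₂ k≥ | inj₂ k′≥ =
        inj₁ (∸-cancelˡ-≡ (<⇒≤ k<g) (<⇒≤ k′<g) (trans (sym (m≥n⇒m⊓n≡n k≥)) (trans same (m≥n⇒m⊓n≡n k′≥))))

  cycDistFrom1 : ℕ → ℕ
  cycDistFrom1 zero    = cycDist (pred g)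
  cycDistFrom1 (suc k) = cycDist k

  shortestWalk-to-C1 : ∀ p k → k < g → ShortestWalk G (C (p + k)) (C (p + 1)) (cycDistFrom1 k)
  shortestWalk-to-C1 p zero _ =
    subst (λ x → ShortestWalk G x (C (p + 1)) (cycDist (pred g))) wraps (shortestWalk-on-cycle (p + 1) (pred g) ≤-refl)
    where
    wraps : C (p + 1 + pred g) ≡ C (p + 0)
    wraps = trans (cong C (+-assoc p 1 (pred g))) (trans (C-periodic p) (cong C (sym (+-identityʳ p))))
  shortestWalk-to-C1 p (suc k) 1+k<g =
    subst (λ x → ShortestWalk G x (C (p + 1)) (cycDist k)) (cong C (+-assoc p 1 k))
      (shortestWalk-on-cycle (p + 1) k (<-trans (n<1+n k) 1+k<g))

  cycDist-cycDistFrom1-injective : ∀ {k k′} → k < g → k′ < g →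
                      cycDist k ≡ cycDist k′ → cycDistFrom1 k ≡ cycDistFrom1 k′ → k ≡ k′
  cycDist-cycDistFrom1-injective {k} {k′} k<g k′<g same same₁ with cycDist-≡ k<g k′<g same
  ... | inj₁ k≡k′ = k≡k′
  cycDist-cycDistFrom1-injective {zero} _ k′<g _ _ | inj₂ k′≡g = contradiction k′≡g (<⇒≢ k′<g)
  cycDist-cycDistFrom1-injective {suc a} {zero} k<g _ _ _ | inj₂ k+0≡g =
    contradiction (trans (sym (+-identityʳ (suc a))) k+0≡g) (<⇒≢ k<g)
  cycDist-cycDistFrom1-injective {suc a} {suc a′} k<g k′<g _ same₁ | inj₂ k+k′≡g
    with cycDist-≡ (<-trans (n<1+n a) k<g) (<-trans (n<1+n a′) k′<g) same₁
  ... | inj₁ a≡a′ = cong suc a≡a′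
  ... | inj₂ a+a′≡g = contradiction 2+g≡g (<⇒≢ (≤-trans (n<1+n g) (n≤1+n (suc g))) ∘ sym)
    where
    2+g≡g : suc (suc g) ≡ g
    2+g≡g = trans (cong (λ j → suc (suc j)) (sym a+a′≡g)) (trans (cong suc (sym (+-suc a a′))) k+k′≡g)

module SmallResolvingSet {n : ℕ} {G : Graph n} {k : ℕ} (girth : Girth G k) (connected : Connected G) where

  open Isometry girth

  ¬¬-shortestWalk-to : ∀ u w → ¬ ¬ (∃[ d ] ShortestWalk G u w d)
  ¬¬-shortestWalk-to u w = ¬¬-shortestWalk (fromWalk (proj₂ (connected u w)))

  module Construction (v : Fin n) (p : ℕ) (v-position : (∀ y → C y ≢ v) ⊎ v ≡ C p)
                      (z₀ : Fin n) (z₀≢v : z₀ ≢ v) (z₀⇝̸C₁ : ¬ ReachableAvoiding G v z₀ (C (p + 1))) where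

    Reach : Fin n → Set
    Reach = ReachableAvoiding G v z₀

    C-≢-v : ∀ {j} → 0 < j → j < g → C (p + j) ≢ v
    C-≢-v {j} 0<j j<g = by-position v-position
      where
      by-position : (∀ y → C y ≢ v) ⊎ v ≡ C p → C (p + j) ≢ v
      by-position (inj₁ v∉C)  = v∉C (p + j)
      by-position (inj₂ v≡Cp) Cpj≡v = <⇒≢ 0<j (sym (C-window p j j<g (sym (trans Cpj≡v v≡Cp))))

    cycle-unreachable : ∀ {j} → 0 < j → j < g → ¬ Reach (C (p + j))
    cycle-unreachable {suc j} _ 1+j<g z₀⇝ = z₀⇝̸C₁ (reachable-trans z₀⇝ (j , back , avoids))
      where
      back : SeqWalk G (C (p + suc j)) (C (p + 1)) j
      back = cast-start (cong C (+-assoc p 1 j)) (reverse (arc (p + 1) j))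
      avoids : Avoids v back
      avoids i _ Cᵢ≡v = C-≢-v (s≤s z≤n) (≤-<-trans (s≤s (m∸n≤m j i)) 1+j<g)
                          (trans (cong C (sym (+-assoc p 1 (j ∸ i)))) Cᵢ≡v)

    neighbour : ∃[ x ] (Adj G x v × Reach x)
    neighbour = walk-into⇒reachable-neighbour z₀≢v (fromWalk (proj₂ (connected z₀ v)))

    x : Fin n
    x = proj₁ neighbour

    x-v : Adj G x v
    x-v = proj₁ (proj₂ neighbour)

    z₀⇝x : Reach x
    z₀⇝x = proj₂ (proj₂ neighbour)

    x≢v : x ≢ v
    x≢v x≡v = irrefl G (subst (λ y → Adj G y v) x≡v x-v)

    K : ℕ
    K = pred g

    ε : ℕ → Fin n
    ε zero    = v
    ε (suc e) = C (p + suc (suc e))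

    ε-injective : ∀ {i i′} → i < K → i′ < K → ε i ≡ ε i′ → i ≡ i′
    ε-injective {zero}  {zero}   _   _    _  = refl
    ε-injective {zero}  {suc e′} _   e′<K v≡ = contradiction (sym v≡) (C-≢-v (s≤s z≤n) (s≤s e′<K))
    ε-injective {suc e} {zero}   e<K _    ≡v = contradiction ≡v (C-≢-v (s≤s z≤n) (s≤s e<K))
    ε-injective {suc e} {suc e′} e<K e′<K ≡  = suc-injective (C-injective p (s≤s e<K) (s≤s e′<K) ≡)

    InO : Fin n → Set
    InO u = ∃[ i ] (i < K × u ≡ ε i)

    inO? : ∀ u → Dec (InO u)
    inO? u = anyUpTo? (λ i → u ≟ᶠ ε i) K

    W : Subset n
    W = ∁ (subsetOf inO?)

    ∉O⇒∈W : ∀ {u} → ¬ InO u → u ∈ W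
    ∉O⇒∈W u∉O = x∉p⇒x∈∁p (u∉O ∘ subsetOf-∈ inO?)

    ∉W⇒∈O : ∀ {u} → u ∉ W → InO u
    ∉W⇒∈O u∉W = subsetOf-∈ inO? (x∉∁p⇒x∈p u∉W)

    ∣W∣≤ : ∣ W ∣ ≤ n ∸ K
    ∣W∣≤ = subst (_≤ n ∸ K) (sym (∣∁p∣≡n∸∣p∣ (subsetOf inO?)))
      (∸-monoʳ-≤ n (injection-into⇒≤∣p∣ (subsetOf inO?) ε ε-injective (λ {i} i<K → ∈-subsetOf inO? (i , i<K , refl))))

    x∈W : x ∈ W
    x∈W = ∉O⇒∈W λ
      { (zero  , _   , x≡v) → x≢v x≡v
      ; (suc e , e<K , x≡)  → cycle-unreachable (s≤s z≤n) (s≤s e<K) (subst Reach x≡ z₀⇝x)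
      }

    C₁∈W : C (p + 1) ∈ W
    C₁∈W = ∉O⇒∈W λ
      { (zero  , _   , C₁≡v) → C-≢-v (s≤s z≤n) (s≤s (s≤s z≤n)) C₁≡v
      ; (suc e , e<K , C₁≡)  → contradiction (C-injective p (s≤s (s≤s z≤n)) (s≤s e<K) C₁≡) λ ()
      }

    Separated : Fin n → Fin n → Set
    Separated u u′ = ∃[ w ] (w ∈ W × ∃[ a ] ∃[ b ] (Dist G u w a × Dist G u′ w b × a ≢ b))

    separated : ∀ {u u′ w a b} → w ∈ W → ShortestWalk G u w a → ShortestWalk G u′ w b → a ≢ b → Separated u u′
    separated w∈W u⇝w u′⇝w a≢b = _ , w∈W , _ , _ , toDist u⇝w , toDist u′⇝w , a≢b

    separated-sym : ∀ {u u′} → Separated u u′ → Separated u′ u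
    separated-sym (w , w∈W , a , b , du , du′ , a≢b) = w , w∈W , b , a , du′ , du , a≢b ∘ sym

    separated-by-self : ∀ {u u′} → u ≢ u′ → u ∈ W → ¬ ¬ Separated u u′
    separated-by-self {u} {u′} u≢u′ u∈W = ¬¬-map
      (λ (d , u′⇝u) → separated u∈W (shortestWalk-self u) u′⇝u
                         λ 0≡d → u≢u′ (sym (shortestWalk-0⇒≡ (subst (ShortestWalk G u′ u) (sym 0≡d) u′⇝u))))
      (¬¬-shortestWalk-to u′ u)

    separate-on-cycle : ∀ {L c} → L ∈ W → (∀ {j} → j < g → ShortestWalk G (C (p + j)) L (c + cycDist j)) →
                        ∀ {j j′} → j < g → j′ < g → j ≢ j′ → Separated (C (p + j)) (C (p + j′))
    separate-on-cycle {c = c} L∈W to-L {j} {j′} j<g j′<g j≢j′ with cycDist j ≟ℕ cycDist j′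
    ... | no differ = separated L∈W (to-L j<g) (to-L j′<g) (differ ∘ +-cancelˡ-≡ c _ _)
    ... | yes same  = separated C₁∈W (shortestWalk-to-C1 p j j<g) (shortestWalk-to-C1 p j′ j′<g)
                        (j≢j′ ∘ cycDist-cycDistFrom1-injective j<g j′<g same)

    -- When v = C p, every walk from the cycle to x passes through v.
    shortestWalk-to-x : v ≡ C p → ∀ {j} → j < g → ShortestWalk G (C (p + j)) x (1 + cycDist j)
    shortestWalk-to-x v≡Cp {j} j<g =
      cast-length (+-comm (cycDist j) 1) (proj₁ (shortestWalk-on-cycle p j j<g) ++ cast-start v≡Cp (edge (adj-sym G x-v))) ,
      no-shorter j j<g
      where
      no-shorter : ∀ j → j < g → ∀ l → l < 1 + cycDist j → ¬ SeqWalk G (C (p + j)) x l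
      no-shorter zero _ zero _ w =
        x≢v (trans (sym (at-end w)) (trans (at-start w) (trans (cong C (+-identityʳ p)) (sym v≡Cp))))
      no-shorter zero _ (suc _) (s≤s ()) _
      no-shorter (suc j) 1+j<g l l<1+d w with unreachable⇒walk-meets z₀⇝x x≢v (cycle-unreachable (s≤s z≤n) 1+j<g) w
      ... | i , i<l , wᵢ≡v = <⇒≱ (<-≤-trans i<l (s≤s⁻¹ l<1+d))
            (cycDist-≤-length p (suc j) 1+j<g (reverse (cast-end (trans wᵢ≡v v≡Cp) (take w i (<⇒≤ i<l)))))

    shortestWalk-v-x : ShortestWalk G v x 1
    shortestWalk-v-x = edge (adj-sym G x-v) , λ
      { zero    _        w → x≢v (sym (trans (sym (at-start w)) (at-end w)))
      ; (suc _) (s≤s ()) _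
      }

    separate-v-from-cycle : (∀ y → C y ≢ v) → ∀ {j} → 0 < j → j < g → ¬ ¬ Separated v (C (p + j))
    separate-v-from-cycle v∉C {j} 0<j j<g = ¬¬-map
      (λ (d , Cⱼ⇝x) → separated x∈W shortestWalk-v-x Cⱼ⇝x λ 1≡d → cycle-unreachable 0<j j<g (adjacent 1≡d Cⱼ⇝x))
      (¬¬-shortestWalk-to (C (p + j)) x)
      where
      adjacent : ∀ {d} → 1 ≡ d → ShortestWalk G (C (p + j)) x d → Reach (C (p + j))
      adjacent refl (w , _) =
        reachable-trans z₀⇝x (reachable-sym (edge-reachable (subst (Adj G _) (at-end w) (first-edge w)) (v∉C (p + j)) x≢v))

    separate-in-O-on-cycle : v ≡ C p → ∀ {i i′} → i < K → i′ < K → i ≢ i′ → Separated (ε i) (ε i′)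
    separate-in-O-on-cycle v≡Cp {i} {i′} i<K i′<K i≢i′ =
      subst₂ Separated (sym (ε≡ i)) (sym (ε≡ i′))
        (separate-on-cycle x∈W (shortestWalk-to-x v≡Cp) (κ<g i<K) (κ<g i′<K) (i≢i′ ∘ κ-injective))
      where
      κ : ℕ → ℕ
      κ zero    = 0
      κ (suc e) = suc (suc e)
      κ<g : ∀ {i} → i < K → κ i < g
      κ<g {zero}  _   = s≤s z≤n
      κ<g {suc e} e<K = s≤s e<K
      κ-injective : ∀ {i i′} → κ i ≡ κ i′ → i ≡ i′
      κ-injective {zero}  {zero}   _ = refl
      κ-injective {suc e} {suc e′} ≡ = suc-injective ≡
      ε≡ : ∀ i → ε i ≡ C (p + κ i)
      ε≡ zero    = trans v≡Cp (cong C (sym (+-identityʳ p)))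
      ε≡ (suc e) = refl

    separate-in-O-off-cycle : (∀ y → C y ≢ v) → ∀ {i i′} → i < K → i′ < K → i ≢ i′ → ¬ ¬ Separated (ε i) (ε i′)
    separate-in-O-off-cycle v∉C {zero}  {zero}   _   _    0≢0  = contradiction refl 0≢0
    separate-in-O-off-cycle v∉C {zero}  {suc e′} _   e′<K _    = separate-v-from-cycle v∉C (s≤s z≤n) (s≤s e′<K)
    separate-in-O-off-cycle v∉C {suc e} {zero}   e<K _    _    =
      ¬¬-map separated-sym (separate-v-from-cycle v∉C (s≤s z≤n) (s≤s e<K))
    separate-in-O-off-cycle v∉C {suc e} {suc e′} e<K e′<K e≢e′ = contradiction
      (separate-on-cycle Cₚ∈W (λ {j} j<g → shortestWalk-on-cycle p j j<g) (s≤s e<K) (s≤s e′<K)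
        (e≢e′ ∘ suc-injective))
      where
      Cₚ∈W : C p ∈ W
      Cₚ∈W = ∉O⇒∈W λ
        { (zero  , _   , Cₚ≡v) → v∉C p Cₚ≡v
        ; (suc e , e<K , Cₚ≡)  → contradiction (C-injective p (s≤s z≤n) (s≤s e<K) (trans (cong C (+-identityʳ p)) Cₚ≡)) λ ()
        }

    ¬¬-separated-O : ∀ {i i′} → i < K → i′ < K → i ≢ i′ → ¬ ¬ Separated (ε i) (ε i′)
    ¬¬-separated-O {i} {i′} i<K i′<K i≢i′ = by-position v-position
      where
      by-position : (∀ y → C y ≢ v) ⊎ v ≡ C p → ¬ ¬ Separated (ε i) (ε i′)
      by-position (inj₁ v∉C)  = separate-in-O-off-cycle v∉C i<K i′<K i≢i′
      by-position (inj₂ v≡Cp) = contradiction (separate-in-O-on-cycle v≡Cp i<K i′<K i≢i′)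

    ¬¬-separated : ∀ u u′ → u ≢ u′ → ¬ ¬ Separated u u′
    ¬¬-separated u u′ u≢u′ with u ∈? W | u′ ∈? W
    ... | yes u∈W | _        = separated-by-self u≢u′ u∈W
    ... | no _    | yes u′∈W = ¬¬-map separated-sym (separated-by-self (u≢u′ ∘ sym) u′∈W)
    ... | no u∉W  | no u′∉W with ∉W⇒∈O u∉W | ∉W⇒∈O u′∉W
    ...   | i , i<K , u≡εi | i′ , i′<K , u′≡εi′ =
            subst₂ (λ a b → ¬ ¬ Separated a b) (sym u≡εi) (sym u′≡εi′)
              (¬¬-separated-O i<K i′<K λ i≡i′ → u≢u′ (trans u≡εi (trans (cong ε i≡i′) (sym u′≡εi′))))

    ¬¬-resolving : ¬ ¬ Resolving G W
    ¬¬-resolving = ¬¬-∀-Fin λ u → ¬¬-∀-Fin λ u′ → ¬¬-→ (¬? (u ≟ᶠ u′)) (¬¬-separated u u′)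

  n∸K≡n∸k+1 : n ∸ pred g ≡ n ∸ k + 1
  n∸K≡n∸k+1 = begin
    n ∸ pred g   ≡⟨ +-∸-assoc 1 (subst (_≤ n) (Cycle.len (proj₁ girth)) (cycle-length≤order (proj₁ girth))) ⟩
    suc (n ∸ g)  ≡⟨ +-comm 1 (n ∸ g) ⟩
    n ∸ g + 1    ≡⟨ cong (λ j → n ∸ j + 1) (sym (Cycle.len (proj₁ girth))) ⟩
    n ∸ k + 1    ∎
    where open ≡-Reasoning

  -- One of the two sides a, a′ of the cut vertex v is cut off from C (p + 1); it plays the role of z₀.
  cutVertex⇒¬¬smallResolvingSet : ∀ {v} → CutVertex G v → ¬ ¬ (∃[ W ] (Resolving G W × ∣ W ∣ ≤ n ∸ k + 1))
  cutVertex⇒¬¬smallResolvingSet {v} (a , a′ , a≢v , a′≢v , a⇝̸a′) no-small = from-position position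
    where
    position : ∃[ p ] ((∀ y → C y ≢ v) ⊎ v ≡ C p)
    position with onCycle? v
    ... | yes (p , _ , v≡Cp) = p , inj₂ v≡Cp
    ... | no v∉C             = 0 , inj₁ λ y Cy≡v → v∉C (subst OnCycle Cy≡v (C-onCycle y))
    from-position : ∃[ p ] ((∀ y → C y ≢ v) ⊎ v ≡ C p) → ⊥
    from-position (p , v-position) = ¬¬-reaches a a≢v λ a⇝ → ¬¬-reaches a′ a′≢v λ a′⇝ →
      let (l , walk) = reachable⇒walkAvoiding (reachable-trans a⇝ (reachable-sym a′⇝)) in a⇝̸a′ l walk
      where
      ¬¬-reaches : ∀ z₀ → z₀ ≢ v → ¬ ¬ ReachableAvoiding G v z₀ (C (p + 1))
      ¬¬-reaches z₀ z₀≢v z₀⇝̸C₁ = let open Construction v p v-position z₀ z₀≢v z₀⇝̸C₁ in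
        ¬¬-resolving λ resolves → no-small (W , resolves , subst (∣ W ∣ ≤_) n∸K≡n∸k+1 ∣W∣≤)

proposition2p4 : ∀ (n : ℕ) (G : Graph n) → Connected G → HasCycle G →
  ∀ (b g : ℕ) → MetricDim G b → Girth G g → b ≡ n ∸ g + 2 → TwoConnected G
proposition2p4 n G connected _ b g (_ , minimal) girth b≡n∸g+2 =
  connected , ≤-trans (cycle-length≥3 (proj₁ girth)) (cycle-length≤order (proj₁ girth)) , no-cut-vertex
  where
  no-cut-vertex : ∀ v → ¬ CutVertex G v
  no-cut-vertex v cut = SmallResolvingSet.cutVertex⇒¬¬smallResolvingSet girth connected cut
    λ (W , resolves , ∣W∣≤n∸g+1) →
      <⇒≱ (≤-<-trans ∣W∣≤n∸g+1 (subst (n ∸ g + 1 <_) (sym b≡n∸g+2) (+-monoʳ-< (n ∸ g) ≤-refl))) (minimal W resolves)
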